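{- Let $G$ be a graph with a weak support vertex $u$ of degree $2$, let $v$ be the leaf adjacent to $u$, and let $G'=G-\{u,v\}$. Then $\gamma_{\rm SMB}(G)-1\le\gamma_{\rm SMB}(G')$.
   Context: A leaf is a vertex of degree $1$; a support vertex is a neighbor of a leaf; it is weak if it is adjacent to exactly one leaf. All graphs are finite and simple; $N_G[v]$ is the closed neighborhood of $v$. The Maker-Breaker domination game on $G$ is played by Dominator and Staller, who alternately play a vertex not played before. Dominator wins if the set of vertices he has played is a dominating set of $G$; Staller wins if she has played all vertices of $N_G[v]$ for some $v\in V(G)$. In the D-game Dominator moves first. $\gamma_{\rm SMB}(G)$ is the smallest integer $k$ such that in the D-game, under any strategy of Dominator, Staller can win having played at most $k$ vertices; the value is $\infty$ if Staller has no winning strategy (with $\infty-1=\infty$). -}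

module Defs where

open import Data.Nat using (ℕ; zero; suc; _≡ᵇ_)
open import Data.Bool using (Bool; true; false; T; _∧_)
open import Data.Fin using (Fin)
open import Data.Fin.Subset using (Subset; _∈_; _∉_; _∪_; ⁅_⁆; ∣_∣; ⊥)
open import Data.Vec using (tabulate)
open import Data.Product using (Σ; _×_; ∃)
open import Data.Sum using (_⊎_)
open import Relation.Nullary using (¬_)
open import Relation.Binary.PropositionalEquality using (_≡_)

record Graph : Set where
  field
    n      : ℕ
    adj    : Fin n → Fin n → Bool
    sym    : ∀ x y → adj x y ≡ adj y x
    irrefl : ∀ x → adj x x ≡ false
open Graph public

Adj : (G : Graph) → Fin (n G) → Fin (n G) → Set
Adj G x y = T (adj G x y)

InN : (G : Graph) → Fin (n G) → Fin (n G) → Set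
InN G v w = (w ≡ v) ⊎ Adj G v w

deg : (G : Graph) → Fin (n G) → ℕ
deg G x = ∣ tabulate (adj G x) ∣

isLeaf : (G : Graph) → Fin (n G) → Bool
isLeaf G x = deg G x ≡ᵇ 1

Leaf : (G : Graph) → Fin (n G) → Set
Leaf G x = deg G x ≡ 1

WeakSupport : (G : Graph) → Fin (n G) → Set
WeakSupport G u = ∣ tabulate (λ x → adj G u x ∧ isLeaf G x) ∣ ≡ 1

Dominates : (G : Graph) → Subset (n G) → Set
Dominates G D = ∀ v → ∃ λ w → w ∈ D × InN G v w

StallerWon : (G : Graph) → Subset (n G) → Set
StallerWon G S = ∃ λ v → ∀ w → InN G v w → w ∈ S

Free : (G : Graph) → Subset (n G) → Subset (n G) → Fin (n G) → Set
Free G D S x = x ∉ D × x ∉ S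

-- StallerWinsD G D S k : position with Dominator's set D, Staller's set S,
-- Dominator to move; Staller can force a win playing at most k more vertices
-- (against every strategy of Dominator).
-- StallerWinsS : the same with Staller to move.
mutual
  StallerWinsD : (G : Graph) → Subset (n G) → Subset (n G) → ℕ → Set
  StallerWinsD G D S k =
    StallerWon G S ⊎
    (¬ Dominates G D × (∀ x → Free G D S x → StallerWinsS G (D ∪ ⁅ x ⁆) S k))

  StallerWinsS : (G : Graph) → Subset (n G) → Subset (n G) → ℕ → Set
  StallerWinsS G D S zero = Data.Empty.⊥
    where import Data.Empty
  StallerWinsS G D S (suc k) =
    ¬ Dominates G D ×
    (∃ λ x → Free G D S x ×
      (StallerWon G (S ∪ ⁅ x ⁆) ⊎ StallerWinsD G D (S ∪ ⁅ x ⁆) k))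

-- γ_SMB(G) ≤ k  (D-game, starting from the empty position)
γSMB≤ : Graph → ℕ → Set
γSMB≤ G k = StallerWinsD G ⊥ ⊥ k

-- G' is (an isomorphic copy of) G - {u, v}: e embeds V(G') onto V(G) ∖ {u, v}
-- preserving and reflecting adjacency.
IsDeleteTwo : (G : Graph) → Fin (n G) → Fin (n G) → (G' : Graph) → (Fin (n G') → Fin (n G)) → Set
IsDeleteTwo G u v G' e =
  (∀ a b → e a ≡ e b → a ≡ b) ×
  (∀ a → ¬ (e a ≡ u) × ¬ (e a ≡ v)) ×
  (∀ y → ¬ (y ≡ u) → ¬ (y ≡ v) → ∃ λ a → e a ≡ y) ×
  (∀ a b → adj G' a b ≡ adj G (e a) (e b))

-- Staller transports a winning strategy for G' = G - {u, v} to G along e.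
-- Dominator's moves are mirrored in G' (e a by a, u by the other neighbour w of
-- u, anything else by an arbitrary free vertex), and Staller answers with the
-- image of her G'-move.  A closed neighbourhood N[a] she completes in G' maps
-- onto N[e a], except that N[w] also contains u; this is harmless while Staller
-- holds u or Dominator holds w in G'.  So Staller answers a first move other
-- than u by taking u, and if Dominator then does not take v, she takes v and
-- completes N[v] = {u, v}.  Either way she needs at most one move more.
module Submission where

open import Defs hiding (sym)
open import Data.Nat using (ℕ; zero; suc; _≤_; s≤s)
open import Data.Nat.Properties using (≤-trans; ≤-reflexive; ≤-pred)
open import Data.Bool using (T)
open import Data.Bool.Properties using (T-≡)
open import Data.Fin using (Fin)
open import Data.Fin.Properties using (_≟_; any?; all?; ¬∀⟶∃¬)
open import Data.Fin.Subset using (Subset; _∈_; _∉_; _⊆_; _∪_; _-_; ⁅_⁆; ∣_∣) renaming (⊥ to ∅)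
open import Data.Fin.Subset.Properties
  using (_∈?_; ∉⊥; x∈⁅x⁆; x∈⁅y⁆⇒x≡y; ∣⁅x⁆∣≡1; x∈p∪q⁻; x∈p∪q⁺; p⊆q⇒∣p∣≤∣q∣;
         x∈p∧x≢y⇒x∈p-y; x∈p⇒∣p-x∣<∣p∣)
open import Data.Vec using (tabulate)
open import Data.Vec.Properties using (lookup∘tabulate; []=⇒lookup; lookup⇒[]=)
open import Data.Product using (_×_; ∃; _,_; proj₁; proj₂) renaming (map₁ to ×-map₁)
open import Data.Sum using (_⊎_; inj₁; inj₂; [_,_]′; map₂) renaming (map to ⊎-map)
open import Data.Empty using (⊥-elim)
open import Function using (_∘_; Equivalence)
open import Relation.Nullary using (¬_; Dec; yes; no; contradiction)
open import Relation.Nullary.Decidable using (_×-dec_; _⊎-dec_; _→-dec_; ¬?; decidable-stable; T?)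
open import Relation.Binary.PropositionalEquality using (_≡_; _≢_; refl; sym; trans; subst)

2≰1 : ¬ 2 ≤ 1
2≰1 (s≤s ())

module _ {m : ℕ} where

  ∈⇒1≤∣p∣ : ∀ {p : Subset m} {x} → x ∈ p → 1 ≤ ∣ p ∣
  ∈⇒1≤∣p∣ {p} {x} x∈p = subst (_≤ ∣ p ∣) (∣⁅x⁆∣≡1 x) (p⊆q⇒∣p∣≤∣q∣ ⁅x⁆⊆p)
    where
    ⁅x⁆⊆p : ⁅ x ⁆ ⊆ p
    ⁅x⁆⊆p y∈⁅x⁆ = subst (_∈ p) (sym (x∈⁅y⁆⇒x≡y x y∈⁅x⁆)) x∈p

  ≢∈⇒2≤∣p∣ : ∀ {p : Subset m} {x y} → x ∈ p → y ∈ p → x ≢ y → 2 ≤ ∣ p ∣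
  ≢∈⇒2≤∣p∣ x∈p y∈p x≢y =
    ≤-trans (s≤s (∈⇒1≤∣p∣ (x∈p∧x≢y⇒x∈p-y y∈p (x≢y ∘ sym)))) (x∈p⇒∣p-x∣<∣p∣ x∈p)

  ∣p∣≤1⇒unique : ∀ {p : Subset m} → ∣ p ∣ ≤ 1 → ∀ {x y} → x ∈ p → y ∈ p → x ≡ y
  ∣p∣≤1⇒unique ∣p∣≤1 {x} {y} x∈p y∈p =
    decidable-stable (x ≟ y) (λ x≢y → 2≰1 (≤-trans (≢∈⇒2≤∣p∣ x∈p y∈p x≢y) ∣p∣≤1))

  2≤∣p∣⇒∃≢ : ∀ {p : Subset m} → 2 ≤ ∣ p ∣ → ∀ x → ∃ λ y → y ∈ p × y ≢ x
  2≤∣p∣⇒∃≢ {p} 2≤∣p∣ x with any? (λ y → (y ∈? p) ×-dec ¬? (y ≟ x))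
  ... | yes (y , y∈p , y≢x) = y , y∈p , y≢x
  ... | no none = contradiction (≤-trans 2≤∣p∣ ∣p∣≤1) 2≰1
    where
    p⊆⁅x⁆ : p ⊆ ⁅ x ⁆
    p⊆⁅x⁆ {y} y∈p = subst (_∈ ⁅ x ⁆) (sym (decidable-stable (y ≟ x) (λ y≢x → none (y , y∈p , y≢x)))) (x∈⁅x⁆ x)
    ∣p∣≤1 : ∣ p ∣ ≤ 1
    ∣p∣≤1 = subst (∣ p ∣ ≤_) (∣⁅x⁆∣≡1 x) (p⊆q⇒∣p∣≤∣q∣ p⊆⁅x⁆)

module _ (G : Graph) where

  nbhd : Fin (n G) → Subset (n G)
  nbhd x = tabulate (adj G x)

  Adj⇒∈nbhd : ∀ {x y} → Adj G x y → y ∈ nbhd x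
  Adj⇒∈nbhd {x} {y} x~y = lookup⇒[]= y (nbhd x) (trans (lookup∘tabulate (adj G x) y) (Equivalence.to T-≡ x~y))

  ∈nbhd⇒Adj : ∀ {x y} → y ∈ nbhd x → Adj G x y
  ∈nbhd⇒Adj {x} {y} y∈N = Equivalence.from T-≡ (trans (sym (lookup∘tabulate (adj G x) y)) ([]=⇒lookup y∈N))

  Adj-sym : ∀ {x y} → Adj G x y → Adj G y x
  Adj-sym {x} {y} = subst T (Graph.sym G x y)

  Adj-irrefl : ∀ {x} → ¬ Adj G x x
  Adj-irrefl {x} x~x = contradiction (trans (sym (Equivalence.to T-≡ x~x)) (irrefl G x)) (λ ())

  Adj⇒≢ : ∀ {x y} → Adj G x y → x ≢ y
  Adj⇒≢ x~y refl = Adj-irrefl x~y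

  leaf-neighbour-unique : ∀ {v} → Leaf G v → ∀ {x y} → Adj G x v → Adj G y v → x ≡ y
  leaf-neighbour-unique leaf x~v y~v =
    ∣p∣≤1⇒unique (≤-reflexive leaf) (Adj⇒∈nbhd (Adj-sym x~v)) (Adj⇒∈nbhd (Adj-sym y~v))

  deg2-other-neighbour : ∀ {u v} → deg G u ≡ 2 → Adj G u v →
    ∃ λ w → Adj G u w × w ≢ v × (∀ {y} → Adj G u y → y ≡ v ⊎ y ≡ w)
  deg2-other-neighbour {u} {v} deg≡2 u~v with 2≤∣p∣⇒∃≢ (≤-reflexive (sym deg≡2)) v
  ... | w , w∈N , w≢v = w , ∈nbhd⇒Adj w∈N , w≢v , v-or-w
    where
    v-or-w : ∀ {y} → Adj G u y → y ≡ v ⊎ y ≡ w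
    v-or-w {y} u~y with y ≟ v
    ... | yes y≡v = inj₁ y≡v
    ... | no y≢v = inj₂ (∣p∣≤1⇒unique ∣N-v∣≤1 (x∈p∧x≢y⇒x∈p-y (Adj⇒∈nbhd u~y) y≢v) (x∈p∧x≢y⇒x∈p-y w∈N w≢v))
      where
      ∣N-v∣≤1 : ∣ nbhd u - v ∣ ≤ 1
      ∣N-v∣≤1 = ≤-pred (subst (suc ∣ nbhd u - v ∣ ≤_) deg≡2 (x∈p⇒∣p-x∣<∣p∣ (Adj⇒∈nbhd u~v)))

module _ {m : ℕ} {x z : Fin m} where

  ∈-∪⁅⁆⁻ : ∀ {p} → z ∈ p ∪ ⁅ x ⁆ → z ∈ p ⊎ z ≡ x
  ∈-∪⁅⁆⁻ {p} = map₂ (x∈⁅y⁆⇒x≡y x) ∘ x∈p∪q⁻ p ⁅ x ⁆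

  ∈-∅∪⁅⁆⁻ : z ∈ ∅ ∪ ⁅ x ⁆ → z ≡ x
  ∈-∅∪⁅⁆⁻ z∈ with ∈-∪⁅⁆⁻ z∈
  ... | inj₁ z∈∅ = contradiction z∈∅ ∉⊥
  ... | inj₂ z≡x = z≡x

  ∈-∪⁅⁆ˡ : ∀ {p} → z ∈ p → z ∈ p ∪ ⁅ x ⁆
  ∈-∪⁅⁆ˡ = x∈p∪q⁺ ∘ inj₁

  ∈-∪⁅⁆ʳ : ∀ {p} → z ≡ x → z ∈ p ∪ ⁅ x ⁆
  ∈-∪⁅⁆ʳ refl = x∈p∪q⁺ (inj₂ (x∈⁅x⁆ x))

module _ (H : Graph) where

  InN? : ∀ a b → Dec (InN H a b)
  InN? a b = (b ≟ a) ⊎-dec T? (adj H a b)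

  StallerWon? : ∀ S → Dec (StallerWon H S)
  StallerWon? S = any? (λ a → all? (λ b → InN? a b →-dec (b ∈? S)))

  ¬StallerWon-∅ : ¬ StallerWon H ∅
  ¬StallerWon-∅ (a , N[a]⊆∅) = ∉⊥ (N[a]⊆∅ a (inj₁ refl))

  ¬Dominates-∅ : Fin (n H) → ¬ Dominates H ∅
  ¬Dominates-∅ a dom = ∉⊥ (proj₁ (proj₂ (dom a)))

  free-vertex : ∀ {D S} → ¬ Dominates H D → ¬ StallerWon H S → ∃ (Free H D S)
  free-vertex {D} {S} ¬dom ¬won with any? (λ x → ¬? (x ∈? D) ×-dec ¬? (x ∈? S))
  ... | yes free = free
  ... | no none with ¬∀⟶∃¬ (n H) _ (λ a → any? (λ w → (w ∈? D) ×-dec InN? a w)) ¬dom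
  ...   | a , undominated = contradiction (a , N[a]⊆S) ¬won
    where
    N[a]⊆S : ∀ w → InN H a w → w ∈ S
    N[a]⊆S w a∼w = decidable-stable (w ∈? S) λ w∉S →
      none (w , (λ w∈D → undominated (w , w∈D , a∼w)) , w∉S)

  mutual
    StallerWinsD-suc : ∀ {D S} k → StallerWinsD H D S k → StallerWinsD H D S (suc k)
    StallerWinsD-suc k (inj₁ won) = inj₁ won
    StallerWinsD-suc k (inj₂ (¬dom , respond)) = inj₂ (¬dom , λ x free → StallerWinsS-suc k (respond x free))

    StallerWinsS-suc : ∀ {D S} k → StallerWinsS H D S k → StallerWinsS H D S (suc k)
    StallerWinsS-suc (suc k) (¬dom , x , free , reply) = ¬dom , x , free , map₂ (StallerWinsD-suc k) reply

module Shadowing (G : Graph) (u v : Fin (n G)) (G' : Graph) (e : Fin (n G') → Fin (n G))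
  (del : IsDeleteTwo G u v G' e) (w' : Fin (n G')) (u~v : Adj G u v)
  (nbr-v : ∀ {y} → Adj G y v → y ≡ u)
  (nbr-u : ∀ {y} → Adj G u y → y ≡ v ⊎ y ≡ e w')
  where

  e-injective : ∀ {a b} → e a ≡ e b → a ≡ b
  e-injective = proj₁ del _ _

  e≢u : ∀ a → e a ≢ u
  e≢u a = proj₁ (proj₁ (proj₂ del) a)

  e≢v : ∀ a → e a ≢ v
  e≢v a = proj₂ (proj₁ (proj₂ del) a)

  u≢v : u ≢ v
  u≢v = Adj⇒≢ G u~v

  e-onto : ∀ y → y ≢ u → y ≢ v → ∃ λ a → e a ≡ y
  e-onto = proj₁ (proj₂ (proj₂ del))

  Adj-e⁻ : ∀ {a b} → Adj G (e a) (e b) → Adj G' a b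
  Adj-e⁻ {a} {b} = subst T (sym (proj₂ (proj₂ (proj₂ del)) a b))

  e-neighbour : ∀ a {y} → Adj G (e a) y → (y ≡ u × a ≡ w') ⊎ ∃ λ b → y ≡ e b × Adj G' a b
  e-neighbour a {y} ea~y with y ≟ u
  ... | yes refl = inj₁ (refl , [ (λ ea≡v → contradiction ea≡v (e≢v a)) , e-injective ]′ (nbr-u (Adj-sym G ea~y)))
  ... | no y≢u with y ≟ v
  ...   | yes refl = contradiction (nbr-v ea~y) (e≢u a)
  ...   | no y≢v with e-onto y y≢u y≢v
  ...     | b , refl = inj₂ (b , refl , Adj-e⁻ ea~y)

  -- N_G[e a] is the image of N_G'[a], plus u when a = w'; u-covered handles that extra vertex.
  record Tracks (D S : Subset (n G)) (D' S' : Subset (n G')) : Set where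
    field
      S'⊆S      : ∀ {a} → a ∈ S' → e a ∈ S
      D⊆D'      : ∀ {a} → e a ∈ D → a ∈ D'
      disjoint  : ∀ {x} → x ∈ D → x ∉ S
      u-covered : u ∈ S ⊎ (w' ∈ D' × w' ∉ S')
  open Tracks

  module _ {D S : Subset (n G)} {D' S' : Subset (n G')} (t : Tracks D S D' S') where

    StallerWon-transfer : StallerWon G' S' → StallerWon G S
    StallerWon-transfer (a , N[a]⊆S') = e a , N[ea]⊆S
      where
      N[ea]⊆S : ∀ y → InN G (e a) y → y ∈ S
      N[ea]⊆S _ (inj₁ refl) = S'⊆S t (N[a]⊆S' a (inj₁ refl))
      N[ea]⊆S y (inj₂ ea~y) with e-neighbour a ea~y
      ... | inj₂ (b , refl , a~b) = S'⊆S t (N[a]⊆S' b (inj₂ a~b))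
      ... | inj₁ (refl , refl) with u-covered t
      ...   | inj₁ u∈S = u∈S
      ...   | inj₂ (_ , w'∉S') = contradiction (N[a]⊆S' w' (inj₁ refl)) w'∉S'

    Dominates-transfer : Dominates G D → Dominates G' D'
    Dominates-transfer dom a with dom (e a)
    ... | _ , y∈D , inj₁ refl = a , D⊆D' t y∈D , inj₁ refl
    ... | y , y∈D , inj₂ ea~y with e-neighbour a ea~y
    ...   | inj₂ (b , refl , a~b) = b , D⊆D' t y∈D , inj₂ a~b
    ...   | inj₁ (refl , refl) with u-covered t
    ...     | inj₁ u∈S = contradiction u∈S (disjoint t y∈D)
    ...     | inj₂ (w'∈D' , _) = w' , w'∈D' , inj₁ refl

    Tracks-dominator : ∀ {x y} → x ∉ S → (∀ {b} → e b ≡ x → b ∈ D' ⊎ b ≡ y) →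
      Tracks (D ∪ ⁅ x ⁆) S (D' ∪ ⁅ y ⁆) S'
    Tracks-dominator x∉S e⁻x = record
      { S'⊆S      = S'⊆S t
      ; D⊆D'      = [ ∈-∪⁅⁆ˡ ∘ D⊆D' t , [ ∈-∪⁅⁆ˡ , ∈-∪⁅⁆ʳ ]′ ∘ e⁻x ]′ ∘ ∈-∪⁅⁆⁻
      ; disjoint  = [ disjoint t , (λ { refl → x∉S }) ]′ ∘ ∈-∪⁅⁆⁻
      ; u-covered = map₂ (×-map₁ ∈-∪⁅⁆ˡ) (u-covered t)
      }

    Tracks-staller : ∀ {z y} → z ∉ D → y ∉ D' → e y ∈ S ⊎ e y ≡ z →
      Tracks D (S ∪ ⁅ z ⁆) D' (S' ∪ ⁅ y ⁆)
    Tracks-staller z∉D y∉D' ey = record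
      { S'⊆S      = [ ∈-∪⁅⁆ˡ ∘ S'⊆S t , (λ { refl → [ ∈-∪⁅⁆ˡ , ∈-∪⁅⁆ʳ ]′ ey }) ]′ ∘ ∈-∪⁅⁆⁻
      ; D⊆D'      = D⊆D' t
      ; disjoint  = λ x∈D → [ disjoint t x∈D , (λ { refl → z∉D x∈D }) ]′ ∘ ∈-∪⁅⁆⁻
      ; u-covered = ⊎-map ∈-∪⁅⁆ˡ
          (λ { (w'∈D' , w'∉S') → w'∈D' , [ w'∉S' , (λ { refl → y∉D' w'∈D' }) ]′ ∘ ∈-∪⁅⁆⁻ })
          (u-covered t)
      }

    dominator-shadow : ¬ StallerWon G S → ¬ Dominates G' D' → ∀ {x} → x ∉ S →
      ∃ λ y → Free G' D' S' y × (∀ {b} → e b ≡ x → b ∈ D' ⊎ b ≡ y)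
    dominator-shadow ¬won ¬dom' {x} x∉S with any? (λ a → (e a ≟ x) ×-dec ¬? (a ∈? D'))
    ... | yes (a , refl , a∉D') = a , (a∉D' , x∉S ∘ S'⊆S t) , inj₂ ∘ e-injective
    ... | no none with free-vertex G' ¬dom' (¬won ∘ StallerWon-transfer)
    ...   | y , y-free = y , y-free , λ {b} eb≡x →
            inj₁ (decidable-stable (b ∈? D') (λ b∉D' → none (b , eb≡x , b∉D')))

    staller-shadow : ¬ StallerWon G S → ¬ Dominates G D → ∀ {y} → y ∉ D' →
      ∃ λ z → Free G D S z × (e y ∈ S ⊎ e y ≡ z)
    staller-shadow ¬won ¬dom {y} y∉D' with e y ∈? S
    ... | yes ey∈S = let z , z-free = free-vertex G ¬dom ¬won in z , z-free , inj₁ ey∈S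
    ... | no ey∉S = e y , (y∉D' ∘ D⊆D' t , ey∉S) , inj₂ refl

  mutual
    simulateD : ∀ {D S D' S' k} → Tracks D S D' S' → StallerWinsD G' D' S' k → StallerWinsD G D S k
    simulateD t (inj₁ won') = inj₁ (StallerWon-transfer t won')
    simulateD {D} {S} {k = k} t (inj₂ (¬dom' , respond)) with StallerWon? G S
    ... | yes won = inj₁ won
    ... | no ¬won = inj₂ (¬dom' ∘ Dominates-transfer t , answer)
      where
      answer : ∀ x → Free G D S x → StallerWinsS G (D ∪ ⁅ x ⁆) S k
      answer x (_ , x∉S) with dominator-shadow t ¬won ¬dom' x∉S
      ... | y , y-free , e⁻x = simulateS (Tracks-dominator t x∉S e⁻x) ¬won (respond y y-free)

    simulateS : ∀ {D S D' S' k} → Tracks D S D' S' → ¬ StallerWon G S →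
      StallerWinsS G' D' S' k → StallerWinsS G D S k
    simulateS {D} {S} {D'} {S'} {suc k} t ¬won (¬dom' , y , (y∉D' , _) , reply)
      with staller-shadow t ¬won (¬dom' ∘ Dominates-transfer t) y∉D'
    ... | z , z-free@(z∉D , _) , ey =
      ¬dom' ∘ Dominates-transfer t , z , z-free ,
      ⊎-map (StallerWon-transfer t') (simulateD t') reply
      where
      t' : Tracks D (S ∪ ⁅ z ⁆) D' (S' ∪ ⁅ y ⁆)
      t' = Tracks-staller t z∉D y∉D' ey

  dominates⇒u∈D⊎v∈D : ∀ {D} → Dominates G D → u ∈ D ⊎ v ∈ D
  dominates⇒u∈D⊎v∈D {D} dom with dom v
  ... | _ , v∈D , inj₁ refl = inj₂ v∈D
  ... | y , y∈D , inj₂ v~y = inj₁ (subst (_∈ D) (nbr-v (Adj-sym G v~y)) y∈D)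

  staller-wins-at-v : ∀ {D S k} → u ∈ S → u ∉ D → v ∉ D → v ∉ S → StallerWinsS G D S (suc k)
  staller-wins-at-v {S = S} u∈S u∉D v∉D v∉S =
    [ u∉D , v∉D ]′ ∘ dominates⇒u∈D⊎v∈D , v , (v∉D , v∉S) , inj₁ (v , N[v]⊆S∪v)
    where
    N[v]⊆S∪v : ∀ y → InN G v y → y ∈ S ∪ ⁅ v ⁆
    N[v]⊆S∪v _ (inj₁ refl) = ∈-∪⁅⁆ʳ refl
    N[v]⊆S∪v y (inj₂ v~y) = ∈-∪⁅⁆ˡ (subst (_∈ S) (sym (nbr-v (Adj-sym G v~y))) u∈S)

  ¬StallerWon-⁅u⁆ : ¬ StallerWon G (∅ ∪ ⁅ u ⁆)
  ¬StallerWon-⁅u⁆ (a , N[a]⊆u) with ∈-∅∪⁅⁆⁻ (N[a]⊆u a (inj₁ refl))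
  ... | refl = u≢v (sym (∈-∅∪⁅⁆⁻ (N[a]⊆u v (inj₂ u~v))))

  WinsAfterEveryOpening' : ℕ → Set
  WinsAfterEveryOpening' k = ∀ a → Free G' ∅ ∅ a → StallerWinsS G' (∅ ∪ ⁅ a ⁆) ∅ k

  dominator-opens-u : ∀ {k} → WinsAfterEveryOpening' k → StallerWinsS G (∅ ∪ ⁅ u ⁆) ∅ (suc k)
  dominator-opens-u {k} respond = StallerWinsS-suc G k (simulateS t (¬StallerWon-∅ G) (respond w' (∉⊥ , ∉⊥)))
    where
    t : Tracks (∅ ∪ ⁅ u ⁆) ∅ (∅ ∪ ⁅ w' ⁆) ∅
    t = record
      { S'⊆S      = ⊥-elim ∘ ∉⊥
      ; D⊆D'      = λ {a} ea∈D → contradiction (∈-∅∪⁅⁆⁻ ea∈D) (e≢u a)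
      ; disjoint  = λ _ → ∉⊥
      ; u-covered = inj₂ (∈-∪⁅⁆ʳ refl , ∉⊥)
      }

  dominator-opens-v : ∀ {k} → StallerWinsD G' ∅ ∅ k → StallerWinsS G (∅ ∪ ⁅ v ⁆) ∅ (suc k)
  dominator-opens-v hyp =
    ¬Dominates-∅ G' w' ∘ Dominates-transfer t , u , (u≢v ∘ ∈-∅∪⁅⁆⁻ , ∉⊥) , inj₂ (simulateD t hyp)
    where
    t : Tracks (∅ ∪ ⁅ v ⁆) (∅ ∪ ⁅ u ⁆) ∅ ∅
    t = record
      { S'⊆S      = ⊥-elim ∘ ∉⊥
      ; D⊆D'      = λ {a} ea∈D → contradiction (∈-∅∪⁅⁆⁻ ea∈D) (e≢v a)
      ; disjoint  = λ x∈D x∈S → u≢v (trans (sym (∈-∅∪⁅⁆⁻ x∈S)) (∈-∅∪⁅⁆⁻ x∈D))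
      ; u-covered = inj₁ (∈-∪⁅⁆ʳ refl)
      }

  dominator-opens-elsewhere : ∀ {k} → WinsAfterEveryOpening' k → ∀ a → StallerWinsS G (∅ ∪ ⁅ e a ⁆) ∅ (suc k)
  dominator-opens-elsewhere {zero} respond a = ⊥-elim (respond a (∉⊥ , ∉⊥))
  dominator-opens-elsewhere {suc k} respond a =
    ¬dom , u , (e≢u a ∘ sym ∘ ∈-∅∪⁅⁆⁻ , ∉⊥) , inj₂ (inj₂ (¬dom , answer))
    where
    ¬dom : ¬ Dominates G (∅ ∪ ⁅ e a ⁆)
    ¬dom = [ e≢u a ∘ sym ∘ ∈-∅∪⁅⁆⁻ , e≢v a ∘ sym ∘ ∈-∅∪⁅⁆⁻ ]′ ∘ dominates⇒u∈D⊎v∈D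
    answer : ∀ y → Free G (∅ ∪ ⁅ e a ⁆) (∅ ∪ ⁅ u ⁆) y → StallerWinsS G ((∅ ∪ ⁅ e a ⁆) ∪ ⁅ y ⁆) (∅ ∪ ⁅ u ⁆) (suc k)
    answer y (y∉D , y∉S) with y ≟ v
    ... | yes refl = simulateS t ¬StallerWon-⁅u⁆ (respond a (∉⊥ , ∉⊥))
      where
      t : Tracks ((∅ ∪ ⁅ e a ⁆) ∪ ⁅ v ⁆) (∅ ∪ ⁅ u ⁆) (∅ ∪ ⁅ a ⁆) ∅
      t = record
        { S'⊆S      = ⊥-elim ∘ ∉⊥
        ; D⊆D'      = [ ∈-∪⁅⁆ʳ ∘ e-injective ∘ ∈-∅∪⁅⁆⁻ , (λ eb≡v → contradiction eb≡v (e≢v _)) ]′ ∘ ∈-∪⁅⁆⁻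
        ; disjoint  = λ x∈D x∈S → [ (λ x∈ea → e≢u a (trans (sym (∈-∅∪⁅⁆⁻ x∈ea)) (∈-∅∪⁅⁆⁻ x∈S)))
                                 , (λ x≡v → u≢v (trans (sym (∈-∅∪⁅⁆⁻ x∈S)) x≡v)) ]′ (∈-∪⁅⁆⁻ x∈D)
        ; u-covered = inj₁ (∈-∪⁅⁆ʳ refl)
        }
    ... | no y≢v =
      staller-wins-at-v (∈-∪⁅⁆ʳ refl) u∉D v∉D (u≢v ∘ sym ∘ ∈-∅∪⁅⁆⁻)
      where
      u∉D : u ∉ (∅ ∪ ⁅ e a ⁆) ∪ ⁅ y ⁆
      u∉D = [ e≢u a ∘ sym ∘ ∈-∅∪⁅⁆⁻ , (λ { refl → y∉S (∈-∪⁅⁆ʳ refl) }) ]′ ∘ ∈-∪⁅⁆⁻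
      v∉D : v ∉ (∅ ∪ ⁅ e a ⁆) ∪ ⁅ y ⁆
      v∉D = [ e≢v a ∘ sym ∘ ∈-∅∪⁅⁆⁻ , y≢v ∘ sym ]′ ∘ ∈-∪⁅⁆⁻

  γSMB-step : ∀ k → γSMB≤ G' k → γSMB≤ G (suc k)
  γSMB-step k (inj₁ won') = contradiction won' (¬StallerWon-∅ G')
  γSMB-step k hyp@(inj₂ (_ , respond)) = inj₂ (¬Dominates-∅ G u , opening)
    where
    opening : ∀ x → Free G ∅ ∅ x → StallerWinsS G (∅ ∪ ⁅ x ⁆) ∅ (suc k)
    opening x _ with x ≟ u | x ≟ v
    ... | yes refl | _ = dominator-opens-u respond
    ... | no _ | yes refl = dominator-opens-v hyp
    ... | no x≢u | no x≢v with e-onto x x≢u x≢v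
    ...   | a , refl = dominator-opens-elsewhere respond a

proposition4p2 : (G : Graph) (u v : Fin (n G)) →
    WeakSupport G u → deg G u ≡ 2 → Adj G u v → Leaf G v →
    (G' : Graph) (e : Fin (n G') → Fin (n G)) → IsDeleteTwo G u v G' e →
    ∀ k → γSMB≤ G' k → γSMB≤ G (suc k)
proposition4p2 G u v _ deg≡2 u~v leaf G' e del
  with deg2-other-neighbour G deg≡2 u~v
... | w , u~w , w≢v , nbr-u with proj₁ (proj₂ (proj₂ del)) w (Adj⇒≢ G u~w ∘ sym) w≢v
...   | w' , refl = Shadowing.γSMB-step G u v G' e del w' u~v nbr-v nbr-u
  where
  nbr-v : ∀ {y} → Adj G y v → y ≡ u
  nbr-v y~v = leaf-neighbour-unique G leaf y~v u~v
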